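{- Let $H$ be a hypergraph with all vertex and hyperedge weights equal to $1$ (every vertex in some hyperedge, every hyperedge with non-empty support). Let $(V^+\sqcup V^0\sqcup V^-,\,E^+\sqcup E^0\sqcup E^-)$ be its Dulmage–Mendelsohn decomposition and let $\{(V_{\alpha_r},E_{\alpha_r}):r=1,\dots,k\}$ be its spectral decomposition, with $(V_{\alpha_r},E_{\alpha_r})$ the factor of density $\alpha_r$. Then $$V^+=\bigcup_{\alpha_r>1}V_{\alpha_r},\quad V^0=V_1,\quad V^-=\bigcup_{\alpha_r<1}V_{\alpha_r},\qquad E^+=\bigcup_{\alpha_r>1}E_{\alpha_r},\quad E^0=E_1,\quad E^-=\bigcup_{\alpha_r<1}E_{\alpha_r},$$ where $V_1$, $E_1$ denote the factor of density exactly $1$ (empty if no factor has density $1$).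
   Context: A hypergraph $H=(V,E,\mathrm{supp})$ has finite vertex set $V$, finite hyperedge set $E$ and support map $\mathrm{supp}:E\to\mathcal P(V)$; here all weights are $1$, so $\mathrm{wt}$ of a set is its cardinality. A subgraph is a pair $(V',E')$, $V'\subset V$, $E'\subset E$, with $\mathrm{supp}(e)\subset V'$ for all $e\in E'$; its density is $|E'|/|V'|$. A quotient hypergraph is a pair $(V'',E'')$ such that every hyperedge whose support meets $V''$ lies in $E''$, with supports $\mathrm{supp}(e)\cap V''$. There is a unique subgraph of maximum density that is maximal under componentwise inclusion. The spectral decomposition of $H$ is the partition $V=V_{\alpha_1}\sqcup\dots\sqcup V_{\alpha_k}$, $E=E_{\alpha_1}\sqcup\dots\sqcup E_{\alpha_k}$ where inductively $(V_{\alpha_t},E_{\alpha_t})$ is the maximal subgraph of maximum density $\alpha_t$ in the quotient hypergraph $(V\setminus\bigcup_{r<t}V_{\alpha_r},E\setminus\bigcup_{r<t}E_{\alpha_r})$; then $\alpha_1>\dots>\alpha_k>0$. An exterior cover of $H$ is a pair $(\hat V,\hat E)$, $\hat V\subset V$, $\hat E\subset E$, such that for every $v\in V$, $e\in E$ with $v\in\mathrm{supp}(e)$, either $v\in\hat V$ or $e\in\hat E$; it is minimal if it minimizes $|\hat V|+|\hat E|$. With $\mathcal M$ the set of minimal exterior covers, the Dulmage–Mendelsohn decomposition is $V^+=\bigcap_{\mathcal M}\hat V$, $V^-=\bigcap_{\mathcal M}(V\setminus\hat V)$, $V^0=V\setminus(V^+\cup V^-)$, $E^+=\bigcap_{\mathcal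 M}(E\setminus\hat E)$, $E^-=\bigcap_{\mathcal M}\hat E$, $E^0=E\setminus(E^+\cup E^-)$. -}

module Defs where

open import Data.Nat using (ℕ; _+_; _*_; _≤_; _<_)
open import Data.Fin using (Fin)
open import Data.Fin.Subset using (Subset; _∈_; _∉_; _⊆_; _∩_; _─_; ∣_∣; ⊥)
open import Data.Product using (Σ; ∃; _×_; _,_; proj₁; proj₂)
open import Data.Sum using (_⊎_)
open import Data.List using (List; []; _∷_)
open import Relation.Binary.PropositionalEquality using (_≡_)

-- A hypergraph with vertex set Fin n, hyperedge set Fin m, all weights 1.
record Hypergraph : Set where
  field
    n    : ℕ
    m    : ℕ
    supp : Fin m → Subset n
open Hypergraph public

NoIsolatedVertex : Hypergraph → Set
NoIsolatedVertex H = (v : Fin (n H)) → ∃ λ e → v ∈ supp H e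

NoEmptyEdge : Hypergraph → Set
NoEmptyEdge H = (e : Fin (m H)) → ∃ λ v → v ∈ supp H e

IsExteriorCover : (H : Hypergraph) → Subset (n H) → Subset (m H) → Set
IsExteriorCover H V̂ Ê =
  (v : Fin (n H)) (e : Fin (m H)) → v ∈ supp H e → v ∈ V̂ ⊎ e ∈ Ê

IsMinimalExteriorCover : (H : Hypergraph) → Subset (n H) → Subset (m H) → Set
IsMinimalExteriorCover H V̂ Ê =
  IsExteriorCover H V̂ Ê ×
  ((V̂′ : Subset (n H)) (Ê′ : Subset (m H)) → IsExteriorCover H V̂′ Ê′ →
     ∣ V̂ ∣ + ∣ Ê ∣ ≤ ∣ V̂′ ∣ + ∣ Ê′ ∣)

InV⁺ : (H : Hypergraph) → Fin (n H) → Set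
InV⁺ H v = (V̂ : Subset (n H)) (Ê : Subset (m H)) →
  IsMinimalExteriorCover H V̂ Ê → v ∈ V̂

InV⁻ : (H : Hypergraph) → Fin (n H) → Set
InV⁻ H v = (V̂ : Subset (n H)) (Ê : Subset (m H)) →
  IsMinimalExteriorCover H V̂ Ê → v ∉ V̂

InV⁰ : (H : Hypergraph) → Fin (n H) → Set
InV⁰ H v = (InV⁺ H v → Data.Empty.⊥) × (InV⁻ H v → Data.Empty.⊥)
  where import Data.Empty

InE⁺ : (H : Hypergraph) → Fin (m H) → Set
InE⁺ H e = (V̂ : Subset (n H)) (Ê : Subset (m H)) →
  IsMinimalExteriorCover H V̂ Ê → e ∉ Ê

InE⁻ : (H : Hypergraph) → Fin (m H) → Set
InE⁻ H e = (V̂ : Subset (n H)) (Ê : Subset (m H)) →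
  IsMinimalExteriorCover H V̂ Ê → e ∈ Ê

InE⁰ : (H : Hypergraph) → Fin (m H) → Set
InE⁰ H e = (InE⁺ H e → Data.Empty.⊥) × (InE⁻ H e → Data.Empty.⊥)
  where import Data.Empty

-- (V′, E′) is a subgraph of the quotient hypergraph (V″, E″), whose
-- hyperedge supports are supp(e) ∩ V″.
IsSubgraphOf : (H : Hypergraph) → Subset (n H) → Subset (m H) →
               Subset (n H) → Subset (m H) → Set
IsSubgraphOf H V″ E″ V′ E′ =
  V′ ⊆ V″ × E′ ⊆ E″ × ((e : Fin (m H)) → e ∈ E′ → (supp H e ∩ V″) ⊆ V′)

-- (V′, E′) is a subgraph of (V″, E″) (with V′ non-empty, so that its density
-- ∣E′∣/∣V′∣ is defined) of maximum density; densities a/b ≥ c/d are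
-- compared as c * b ≤ a * d.
IsMaxDensitySubgraph : (H : Hypergraph) → Subset (n H) → Subset (m H) →
                       Subset (n H) → Subset (m H) → Set
IsMaxDensitySubgraph H V″ E″ V′ E′ =
  IsSubgraphOf H V″ E″ V′ E′ × 0 < ∣ V′ ∣ ×
  ((V₂ : Subset (n H)) (E₂ : Subset (m H)) → IsSubgraphOf H V″ E″ V₂ E₂ →
     0 < ∣ V₂ ∣ → ∣ E₂ ∣ * ∣ V′ ∣ ≤ ∣ E′ ∣ * ∣ V₂ ∣)

IsMaximalMaxDensitySubgraph : (H : Hypergraph) → Subset (n H) → Subset (m H) →
                              Subset (n H) → Subset (m H) → Set
IsMaximalMaxDensitySubgraph H V″ E″ V′ E′ =
  IsMaxDensitySubgraph H V″ E″ V′ E′ ×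
  ((V₂ : Subset (n H)) (E₂ : Subset (m H)) → IsMaxDensitySubgraph H V″ E″ V₂ E₂ →
     V′ ⊆ V₂ → E′ ⊆ E₂ → (V₂ ≡ V′ × E₂ ≡ E′))

-- A list of factors (V_{α_1},E_{α_1}), …, (V_{α_k},E_{α_k}) is the spectral
-- decomposition of the quotient (V″, E″) if each factor is the maximal
-- maximum-density subgraph of what remains after removing the previous ones,
-- and the factors exhaust V″ and E″.
IsSpectralDecompositionFrom : (H : Hypergraph) → Subset (n H) → Subset (m H) →
                              List (Subset (n H) × Subset (m H)) → Set
IsSpectralDecompositionFrom H V″ E″ [] = V″ ≡ ⊥ × E″ ≡ ⊥
IsSpectralDecompositionFrom H V″ E″ ((Vα , Eα) ∷ rest) =
  IsMaximalMaxDensitySubgraph H V″ E″ Vα Eα ×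
  IsSpectralDecompositionFrom H (V″ ─ Vα) (E″ ─ Eα) rest

IsSpectralDecomposition : (H : Hypergraph) →
                          List (Subset (n H) × Subset (m H)) → Set
IsSpectralDecomposition H = IsSpectralDecompositionFrom H Data.Fin.Subset.⊤ Data.Fin.Subset.⊤
  where import Data.Fin.Subset

{-# OPTIONS --safe #-}
module Submission where

open import Defs
open import Data.Nat using (_<_)
open import Data.Fin using (Fin)
open import Data.Fin.Subset using (Subset; _∈_; ∣_∣)
open import Data.Product using (_×_; proj₁; proj₂)
open import Data.List using (List)
open import Data.List.Relation.Unary.Any using (Any)
open import Function.Bundles using (_⇔_)
open import Relation.Binary.PropositionalEquality using (_≡_)

open import Data.Empty using (⊥-elim)
open import Data.Fin.Subset
  using (_∉_; _⊆_; _∩_; _∪_; _─_; ⊥; ⊤; ⁅_⁆; ⋃; Nonempty; Empty; inside; outside)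
open import Data.Fin.Subset.Properties
  using ( p⊆q⇒∣p∣≤∣q∣; p⊂q⇒∣p∣<∣q∣; ∣p∩q∣≤∣p∣; p∩q⊆p; x∈p∩q⁺; x∈p∩q⁻; x∈p∪q⁻
        ; p⊆p∪q; q⊆p∪q; ∣p∣≤∣p∪q∣; p─q⊆p; x∈p∧x∉q⇒x∈p─q; ∉⊥; ∈⊤; ∣⊥∣≡0; Empty-unique
        ; ∩-zeroˡ; ∩-identityˡ; ⊆-refl; drop-∷-⊆; x∈⁅x⁆; x∈⁅y⁆⇒x≡y; ∣⁅x⁆∣≡1; nonempty?; _∈?_ )
open import Data.List using ([]; _∷_; map)
open import Data.List.Relation.Unary.All using (All; []; _∷_; lookupWith)
import Data.List.Relation.Unary.All as All
import Data.List.Relation.Unary.All.Properties as All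
open import Data.List.Relation.Unary.Any using (here; there)
import Data.List.Relation.Unary.Any as Any
import Data.List.Relation.Unary.Any.Properties as Any
open import Data.Nat using (ℕ; zero; suc; _+_; _*_; _≤_; _⊓_; z≤n; _≤?_; _<?_; >-nonZero)
open import Data.Nat.ListAction using (sum)
open import Data.Nat.Properties
open import Algebra.Properties.CommutativeSemigroup +-commutativeSemigroup using (interchange)
open import Algebra.Properties.CommutativeSemigroup *-commutativeSemigroup using (xy∙z≈xz∙y)
open import Data.Product using (_,_)
open import Data.Sum using (_⊎_; inj₁; inj₂; [_,_]′)
open import Data.Vec using ([]; _∷_; here; there)
open import Data.Bool using (if_then_else_)
open import Function using (_∘_; id)
open import Function.Bundles using (mk⇔)
open import Relation.Binary using (tri<; tri≈; tri>)
open import Relation.Binary.PropositionalEquality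
  using (refl; sym; trans; cong; cong₂; subst; subst₂; module ≡-Reasoning)
open import Relation.Nullary using (¬_; Dec; yes; no; does; contradiction)
open import Relation.Nullary.Decidable using (decidable-stable)
open import Relation.Unary using (Decidable)

-- Every exterior cover (V̂, Ê) pays at least min(∣V_α∣, ∣E_α∣) inside each spectral factor:
-- the uncovered edges of the factor and its covered vertices form a subgraph of the quotient,
-- so the uncovered fraction of the edges is at most the covered fraction of the vertices.
-- The two covers taking all vertices of the factors of density > 1 (resp. ≥ 1) and all edges
-- of the others attain this bound; they are exterior covers because the densities decrease
-- along the decomposition.  Hence a minimal cover is tight on every factor, which puts the
-- vertices of a factor of density > 1 into the cover and its edges out of it, and the reverse
-- for density < 1, while on a factor of density 1 the two covers above make opposite choices.

∣p∣≡∣p∩q∣+∣p─q∣ : ∀ {n} (p q : Subset n) → ∣ p ∣ ≡ ∣ p ∩ q ∣ + ∣ p ─ q ∣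
∣p∣≡∣p∩q∣+∣p─q∣ []            []            = refl
∣p∣≡∣p∩q∣+∣p─q∣ (outside ∷ p) (inside ∷ q)  = ∣p∣≡∣p∩q∣+∣p─q∣ p q
∣p∣≡∣p∩q∣+∣p─q∣ (outside ∷ p) (outside ∷ q) = ∣p∣≡∣p∩q∣+∣p─q∣ p q
∣p∣≡∣p∩q∣+∣p─q∣ (inside ∷ p)  (inside ∷ q)  = cong suc (∣p∣≡∣p∩q∣+∣p─q∣ p q)
∣p∣≡∣p∩q∣+∣p─q∣ (inside ∷ p)  (outside ∷ q) =
  trans (cong suc (∣p∣≡∣p∩q∣+∣p─q∣ p q)) (sym (+-suc _ _))

∣p∩r∣≡∣q∩r∣+∣p─q∩r∣ : ∀ {n} (p q r : Subset n) → q ⊆ p → ∣ p ∩ r ∣ ≡ ∣ q ∩ r ∣ + ∣ (p ─ q) ∩ r ∣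
∣p∩r∣≡∣q∩r∣+∣p─q∩r∣ []            []            []            _ = refl
∣p∩r∣≡∣q∩r∣+∣p─q∩r∣ (outside ∷ p) (inside ∷ q)  _             q⊆p with () ← q⊆p here
∣p∩r∣≡∣q∩r∣+∣p─q∩r∣ (outside ∷ p) (outside ∷ q) (_ ∷ r)       q⊆p =
  ∣p∩r∣≡∣q∩r∣+∣p─q∩r∣ p q r (drop-∷-⊆ q⊆p)
∣p∩r∣≡∣q∩r∣+∣p─q∩r∣ (inside ∷ p)  (inside ∷ q)  (outside ∷ r) q⊆p =
  ∣p∩r∣≡∣q∩r∣+∣p─q∩r∣ p q r (drop-∷-⊆ q⊆p)
∣p∩r∣≡∣q∩r∣+∣p─q∩r∣ (inside ∷ p)  (outside ∷ q) (outside ∷ r) q⊆p =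
  ∣p∩r∣≡∣q∩r∣+∣p─q∩r∣ p q r (drop-∷-⊆ q⊆p)
∣p∩r∣≡∣q∩r∣+∣p─q∩r∣ (inside ∷ p)  (inside ∷ q)  (inside ∷ r)  q⊆p =
  cong suc (∣p∩r∣≡∣q∩r∣+∣p─q∩r∣ p q r (drop-∷-⊆ q⊆p))
∣p∩r∣≡∣q∩r∣+∣p─q∩r∣ (inside ∷ p)  (outside ∷ q) (inside ∷ r)  q⊆p =
  trans (cong suc (∣p∩r∣≡∣q∩r∣+∣p─q∩r∣ p q r (drop-∷-⊆ q⊆p)))
        (sym (+-suc _ _))

∣p∪q∣+∣p∩q∣≡∣p∣+∣q∣ : ∀ {n} (p q : Subset n) → ∣ p ∪ q ∣ + ∣ p ∩ q ∣ ≡ ∣ p ∣ + ∣ q ∣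
∣p∪q∣+∣p∩q∣≡∣p∣+∣q∣ []            []            = refl
∣p∪q∣+∣p∩q∣≡∣p∣+∣q∣ (outside ∷ p) (outside ∷ q) = ∣p∪q∣+∣p∩q∣≡∣p∣+∣q∣ p q
∣p∪q∣+∣p∩q∣≡∣p∣+∣q∣ (inside ∷ p)  (outside ∷ q) = cong suc (∣p∪q∣+∣p∩q∣≡∣p∣+∣q∣ p q)
∣p∪q∣+∣p∩q∣≡∣p∣+∣q∣ (outside ∷ p) (inside ∷ q)  =
  trans (cong suc (∣p∪q∣+∣p∩q∣≡∣p∣+∣q∣ p q)) (sym (+-suc _ _))
∣p∪q∣+∣p∩q∣≡∣p∣+∣q∣ (inside ∷ p)  (inside ∷ q)  =
  cong suc (trans (+-suc _ _) (trans (cong suc (∣p∪q∣+∣p∩q∣≡∣p∣+∣q∣ p q)) (sym (+-suc _ _))))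

x∈p─q⇒x∉q : ∀ {n} {x : Fin n} (p q : Subset n) → x ∈ p ─ q → x ∉ q
x∈p─q⇒x∉q (_ ∷ p) (inside ∷ q)  (there x∈p─q) (there x∈q) = x∈p─q⇒x∉q p q x∈p─q x∈q
x∈p─q⇒x∉q (_ ∷ p) (outside ∷ q) (there x∈p─q) (there x∈q) = x∈p─q⇒x∉q p q x∈p─q x∈q

x∈p∩q∧x∉r⇒x∈p∩q─r : ∀ {n} {x : Fin n} {p q r : Subset n} → x ∈ p ∩ q → x ∉ r → x ∈ p ∩ (q ─ r)
x∈p∩q∧x∉r⇒x∈p∩q─r {p = p} {q} x∈p∩q x∉r =
  x∈p∩q⁺ (proj₁ (x∈p∩q⁻ p q x∈p∩q) , x∈p∧x∉q⇒x∈p─q (proj₂ (x∈p∩q⁻ p q x∈p∩q)) x∉r)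

x∈p⇒0<∣p∣ : ∀ {n} {x : Fin n} {p : Subset n} → x ∈ p → 0 < ∣ p ∣
x∈p⇒0<∣p∣ {x = x} {p} x∈p = begin
  1         ≡⟨ sym (∣⁅x⁆∣≡1 x) ⟩
  ∣ ⁅ x ⁆ ∣ ≤⟨ p⊆q⇒∣p∣≤∣q∣ (λ y∈⁅x⁆ → subst (_∈ p) (sym (x∈⁅y⁆⇒x≡y x y∈⁅x⁆)) x∈p) ⟩
  ∣ p ∣     ∎
  where open ≤-Reasoning

Empty⇒∣p∣≡0 : ∀ {n} {p : Subset n} → Empty p → ∣ p ∣ ≡ 0
Empty⇒∣p∣≡0 {n} empty = trans (cong ∣_∣ (Empty-unique empty)) (∣⊥∣≡0 n)

∣p∩q∣≡0⇒x∉q : ∀ {n} {x : Fin n} {p q : Subset n} → ∣ p ∩ q ∣ ≡ 0 → x ∈ p → x ∉ q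
∣p∩q∣≡0⇒x∉q ∣p∩q∣≡0 x∈p x∈q = <⇒≢ (x∈p⇒0<∣p∣ (x∈p∩q⁺ (x∈p , x∈q))) (sym ∣p∩q∣≡0)

∣p∩q∣≡∣p∣⇒p⊆q : ∀ {n} {p q : Subset n} → ∣ p ∩ q ∣ ≡ ∣ p ∣ → p ⊆ q
∣p∩q∣≡∣p∣⇒p⊆q {p = p} {q} eq {x} x∈p with x ∈? q
... | yes x∈q = x∈q
... | no  x∉q = contradiction eq (<⇒≢ (p⊂q⇒∣p∣<∣q∣ (p∩q⊆p p q , x , x∈p , x∉q ∘ proj₂ ∘ x∈p∩q⁻ p q)))

p⊆q⇒∣p∩q∣≡∣p∣ : ∀ {n} {p q : Subset n} → p ⊆ q → ∣ p ∩ q ∣ ≡ ∣ p ∣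
p⊆q⇒∣p∩q∣≡∣p∣ {p = p} {q} p⊆q =
  ≤-antisym (∣p∩q∣≤∣p∣ p q) (p⊆q⇒∣p∣≤∣q∣ (λ x∈p → x∈p∩q⁺ (x∈p , p⊆q x∈p)))

p⊆q⇒∣p─q∣≡0 : ∀ {n} {p q : Subset n} → p ⊆ q → ∣ p ─ q ∣ ≡ 0
p⊆q⇒∣p─q∣≡0 {p = p} {q} p⊆q =
  Empty⇒∣p∣≡0 λ (x , x∈p─q) → x∈p─q⇒x∉q p q x∈p─q (p⊆q (p─q⊆p p q x∈p─q))

∣p∪q∣≤∣p∣+∣q∣ : ∀ {n} (p q : Subset n) → ∣ p ∪ q ∣ ≤ ∣ p ∣ + ∣ q ∣
∣p∪q∣≤∣p∣+∣q∣ p q = ≤-trans (m≤m+n _ _) (≤-reflexive (∣p∪q∣+∣p∩q∣≡∣p∣+∣q∣ p q))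

∣p∪q∣≡∣p∣+∣q∣ : ∀ {n} {p q : Subset n} → (∀ {x} → x ∈ p → x ∉ q) → ∣ p ∪ q ∣ ≡ ∣ p ∣ + ∣ q ∣
∣p∪q∣≡∣p∣+∣q∣ {p = p} {q} disjoint = begin
  ∣ p ∪ q ∣             ≡⟨ sym (+-identityʳ _) ⟩
  ∣ p ∪ q ∣ + 0         ≡⟨ cong (∣ p ∪ q ∣ +_) (sym (Empty⇒∣p∣≡0 λ (x , x∈p∩q) →
                             let (x∈p , x∈q) = x∈p∩q⁻ p q x∈p∩q in disjoint x∈p x∈q)) ⟩
  ∣ p ∪ q ∣ + ∣ p ∩ q ∣ ≡⟨ ∣p∪q∣+∣p∩q∣≡∣p∣+∣q∣ p q ⟩
  ∣ p ∣ + ∣ q ∣         ∎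
  where open ≡-Reasoning

∣⊥∩p∣≡0 : ∀ {n} (p : Subset n) → ∣ ⊥ ∩ p ∣ ≡ 0
∣⊥∩p∣≡0 {n} p = trans (cong ∣_∣ (∩-zeroˡ p)) (∣⊥∣≡0 n)

x∈⋃⇒Any : ∀ {n} {x : Fin n} (ps : List (Subset n)) → x ∈ ⋃ ps → Any (x ∈_) ps
x∈⋃⇒Any []       x∈⊥ = ⊥-elim (∉⊥ x∈⊥)
x∈⋃⇒Any (p ∷ ps) x∈  = [ here , there ∘ x∈⋃⇒Any ps ]′ (x∈p∪q⁻ p (⋃ ps) x∈)

⊆⋃ : ∀ {n} (ps : List (Subset n)) → All (_⊆ ⋃ ps) ps
⊆⋃ []       = []
⊆⋃ (p ∷ ps) = p⊆p∪q (⋃ ps) ∷ All.map (λ q⊆⋃ps {_} x∈q → q⊆p∪q p (⋃ ps) (q⊆⋃ps x∈q)) (⊆⋃ ps)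

All∧Any⇒Any : ∀ {A : Set} {P Q : A → Set} {xs} → All P xs → Any Q xs → Any (λ x → P x × Q x) xs
All∧Any⇒Any (px ∷ _)   (here qx)  = here (px , qx)
All∧Any⇒Any (_ ∷ pxs) (there qxs) = there (All∧Any⇒Any pxs qxs)

+-tight : ∀ {x x′ y y′} → x ≤ x′ → y ≤ y′ → x′ + y′ ≤ x + y → x′ ≤ x × y′ ≤ y
+-tight {x} {x′} {y} {y′} x≤x′ y≤y′ le =
  +-cancelʳ-≤ y′ x′ x (≤-trans le (+-monoʳ-≤ x y≤y′)) ,
  +-cancelˡ-≤ x y′ y (≤-trans (+-monoˡ-≤ y′ x≤x′) le)

module _ {A : Set} {f g : A → ℕ} where

  sum-mono-≤ : ∀ {xs} → All (λ x → f x ≤ g x) xs → sum (map f xs) ≤ sum (map g xs)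
  sum-mono-≤ []         = z≤n
  sum-mono-≤ (le ∷ les) = +-mono-≤ le (sum-mono-≤ les)

  sum-tight : ∀ {xs} → All (λ x → f x ≤ g x) xs → sum (map g xs) ≤ sum (map f xs) →
              All (λ x → g x ≤ f x) xs
  sum-tight []         _  = []
  sum-tight (le ∷ les) ge = let (hd , tl) = +-tight le (sum-mono-≤ les) ge in hd ∷ sum-tight les tl

u*c≤c*k⇒c≡0 : ∀ {k u} c → k < u → u * c ≤ c * k → c ≡ 0
u*c≤c*k⇒c≡0 zero        _   _  = refl
u*c≤c*k⇒c≡0 {k} {u} c@(suc _) k<u le = contradiction le (<⇒≱ (begin-strict
  c * k <⟨ *-monoʳ-< c k<u ⟩
  c * u ≡⟨ *-comm c u ⟩
  u * c ∎))
  where open ≤-Reasoning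

-- One factor with v vertices, k of them covered, and e = c + u edges, c of them covered;
-- bound says that the uncovered fraction u / e of the edges is at most the covered fraction k / v
-- of the vertices.
module CoverCounts {v e k c u : ℕ} (0<v : 0 < v) (k≤v : k ≤ v) (e≡c+u : e ≡ c + u)
                   (bound : u * v ≤ e * k) where
  open ≤-Reasoning

  e≡u+c : e ≡ u + c
  e≡u+c = trans e≡c+u (+-comm c u)

  u≤k-if-sparse : e ≤ v → u ≤ k
  u≤k-if-sparse e≤v = *-cancelʳ-≤ u k v {{>-nonZero 0<v}} (begin
    u * v ≤⟨ bound ⟩
    e * k ≤⟨ *-monoˡ-≤ k e≤v ⟩
    v * k ≡⟨ *-comm v k ⟩
    k * v ∎)

  dense-covering : k + c ≤ v → k < u → c ≡ 0 × v ≤ k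
  dense-covering k+c≤v k<u = c≡0 , *-cancelˡ-≤ u {{>-nonZero (≤-<-trans z≤n k<u)}} (begin
    u * v ≤⟨ bound ⟩
    e * k ≡⟨ cong (_* k) (trans e≡c+u (cong (_+ u) c≡0)) ⟩
    u * k ∎)
    where
    c≡0 : c ≡ 0
    c≡0 = u*c≤c*k⇒c≡0 c k<u (+-cancelˡ-≤ (u * k) _ _ (begin
      u * k + u * c ≡⟨ sym (*-distribˡ-+ u k c) ⟩
      u * (k + c)   ≤⟨ *-monoʳ-≤ u k+c≤v ⟩
      u * v         ≤⟨ bound ⟩
      e * k         ≡⟨ cong (_* k) e≡c+u ⟩
      (c + u) * k   ≡⟨ *-distribʳ-+ k c u ⟩
      c * k + u * k ≡⟨ +-comm (c * k) (u * k) ⟩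
      u * k + c * k ∎))

  dense-lower : v ≤ e → v ≤ k + c
  dense-lower v≤e with v ≤? k + c
  ... | yes v≤k+c = v≤k+c
  ... | no  v≰k+c = contradiction (≤-trans v≤k (m≤m+n k c)) v≰k+c
    where
    k+c<v : k + c < v
    k+c<v = ≰⇒> v≰k+c
    k<u : k < u
    k<u = +-cancelʳ-< c k u (begin-strict
      k + c <⟨ k+c<v ⟩
      v     ≤⟨ v≤e ⟩
      e     ≡⟨ e≡u+c ⟩
      u + c ∎)
    v≤k : v ≤ k
    v≤k = proj₂ (dense-covering (<⇒≤ k+c<v) k<u)

  cost-lower : v ⊓ e ≤ k + c
  cost-lower with ≤-total v e
  ... | inj₁ v≤e = ≤-trans (m⊓n≤m v e) (dense-lower v≤e)
  ... | inj₂ e≤v = begin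
    v ⊓ e ≤⟨ m⊓n≤n v e ⟩
    e     ≡⟨ e≡u+c ⟩
    u + c ≤⟨ +-monoˡ-≤ c (u≤k-if-sparse e≤v) ⟩
    k + c ∎

  module Tight (tight : k + c ≤ v ⊓ e) where

    k≤u : k ≤ u
    k≤u = +-cancelʳ-≤ c k u (≤-trans tight (≤-trans (m⊓n≤n v e) (≤-reflexive e≡u+c)))

    tight-dense : v < e → k ≡ v × c ≡ 0
    tight-dense v<e = ≤-antisym k≤v (proj₂ covering) , proj₁ covering
      where
      k+c≤v : k + c ≤ v
      k+c≤v = ≤-trans tight (m⊓n≤m v e)
      covering : c ≡ 0 × v ≤ k
      covering = dense-covering k+c≤v (+-cancelʳ-< c k u (begin-strict
        k + c ≤⟨ k+c≤v ⟩
        v     <⟨ v<e ⟩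
        e     ≡⟨ e≡u+c ⟩
        u + c ∎))

    tight-sparse : e < v → k ≡ 0 × u ≡ 0
    tight-sparse e<v = trans k≡u u≡0 , u≡0
      where
      k≡u : k ≡ u
      k≡u = ≤-antisym k≤u (u≤k-if-sparse (<⇒≤ e<v))
      u≡0 : u ≡ 0
      u≡0 = u*c≤c*k⇒c≡0 u e<v (begin
        v * u ≡⟨ *-comm v u ⟩
        u * v ≤⟨ bound ⟩
        e * k ≡⟨ cong (e *_) k≡u ⟩
        e * u ≡⟨ *-comm e u ⟩
        u * e ∎)

    tight-balanced : v ≡ e → k ≡ u
    tight-balanced v≡e = ≤-antisym k≤u (u≤k-if-sparse (≤-reflexive (sym v≡e)))

≥1-upward : ∀ {vg eg vs es} → 0 < vs → es * vg ≤ eg * vs → vs ≤ es → vg ≤ eg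
≥1-upward {vg} {eg} {vs} {es} 0<vs le vs≤es = *-cancelʳ-≤ vg eg vs {{>-nonZero 0<vs}} (begin
  vg * vs ≡⟨ *-comm vg vs ⟩
  vs * vg ≤⟨ *-monoˡ-≤ vg vs≤es ⟩
  es * vg ≤⟨ le ⟩
  eg * vs ∎)
  where open ≤-Reasoning

>1-upward : ∀ {vg eg vs es} → 0 < vg → es * vg ≤ eg * vs → vs < es → vg < eg
>1-upward {vg} {eg} {vs} {es} 0<vg le vs<es = *-cancelʳ-< vs vg eg (begin-strict
  vg * vs ≡⟨ *-comm vg vs ⟩
  vs * vg <⟨ *-monoˡ-< vg {{>-nonZero 0<vg}} vs<es ⟩
  es * vg ≤⟨ le ⟩
  eg * vs ∎)
  where open ≤-Reasoning

mediant-≤ : ∀ a b c d → (a + b) * c ≤ a * (c + d) → b * c ≤ a * d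
mediant-≤ a b c d le =
  +-cancelˡ-≤ (a * c) _ _ (subst₂ _≤_ (*-distribʳ-+ c a b) (*-distribˡ-+ a c d) le)

cross-≤-trans : ∀ {vs es vt et vg eg} → 0 < vt →
                es * vt ≤ et * vs → et * vg ≤ eg * vt → es * vg ≤ eg * vs
cross-≤-trans {vs} {es} {vt} {et} {vg} {eg} 0<vt s≤t t≤g =
  *-cancelʳ-≤ (es * vg) (eg * vs) vt {{>-nonZero 0<vt}} (begin
    es * vg * vt ≡⟨ xy∙z≈xz∙y es vg vt ⟩
    es * vt * vg ≤⟨ *-monoˡ-≤ vg s≤t ⟩
    et * vs * vg ≡⟨ xy∙z≈xz∙y et vs vg ⟩
    et * vg * vs ≤⟨ *-monoˡ-≤ vs t≤g ⟩
    eg * vt * vs ≡⟨ xy∙z≈xz∙y eg vt vs ⟩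
    eg * vs * vt ∎)
  where open ≤-Reasoning

-- Covering a single factor

module _ {n m : ℕ} where

  minSize : Subset n × Subset m → ℕ
  minSize (Vg , Eg) = ∣ Vg ∣ ⊓ ∣ Eg ∣

  coverCost : Subset n → Subset m → Subset n × Subset m → ℕ
  coverCost V̂ Ê (Vg , Eg) = ∣ Vg ∩ V̂ ∣ + ∣ Eg ∩ Ê ∣

  record CoverBound (V̂ : Subset n) (Ê : Subset m) (g : Subset n × Subset m) : Set where
    constructor coverBound
    field
      nonempty  : 0 < ∣ proj₁ g ∣
      uncovered : ∣ proj₂ g ─ Ê ∣ * ∣ proj₁ g ∣ ≤ ∣ proj₂ g ∣ * ∣ proj₁ g ∩ V̂ ∣

module FactorCover {n m} {V̂ : Subset n} {Ê : Subset m} {g : Subset n × Subset m}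
                   (cover-bound : CoverBound V̂ Ê g) where
  private
    Vg : Subset n
    Vg = proj₁ g
    Eg : Subset m
    Eg = proj₂ g

  open CoverCounts {c = ∣ Eg ∩ Ê ∣} {u = ∣ Eg ─ Ê ∣}
    (CoverBound.nonempty cover-bound) (∣p∩q∣≤∣p∣ Vg V̂) (∣p∣≡∣p∩q∣+∣p─q∣ Eg Ê)
    (CoverBound.uncovered cover-bound)

  minSize≤coverCost : minSize g ≤ coverCost V̂ Ê g
  minSize≤coverCost = cost-lower

  module _ (tight : coverCost V̂ Ê g ≤ minSize g) where
    open Tight tight

    dense-factor : ∣ Vg ∣ < ∣ Eg ∣ → Vg ⊆ V̂ × (∀ {x} → x ∈ Eg → x ∉ Ê)
    dense-factor Vg<Eg =
      ∣p∩q∣≡∣p∣⇒p⊆q (proj₁ (tight-dense Vg<Eg)) , ∣p∩q∣≡0⇒x∉q (proj₂ (tight-dense Vg<Eg))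

    sparse-factor : ∣ Eg ∣ < ∣ Vg ∣ → (∀ {x} → x ∈ Vg → x ∉ V̂) × Eg ⊆ Ê
    sparse-factor Eg<Vg = ∣p∩q∣≡0⇒x∉q (proj₁ (tight-sparse Eg<Vg)) , ∣p∩q∣≡∣p∣⇒p⊆q (begin
      ∣ Eg ∩ Ê ∣                ≡⟨ sym (+-identityʳ _) ⟩
      ∣ Eg ∩ Ê ∣ + 0            ≡⟨ cong (∣ Eg ∩ Ê ∣ +_) (sym (proj₂ (tight-sparse Eg<Vg))) ⟩
      ∣ Eg ∩ Ê ∣ + ∣ Eg ─ Ê ∣   ≡⟨ sym (∣p∣≡∣p∩q∣+∣p─q∣ Eg Ê) ⟩
      ∣ Eg ∣                    ∎)
      where open ≡-Reasoning

    balanced-factor-edges : ∣ Vg ∣ ≡ ∣ Eg ∣ → Eg ⊆ Ê → ∀ {x} → x ∈ Vg → x ∉ V̂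
    balanced-factor-edges Vg≡Eg Eg⊆Ê = ∣p∩q∣≡0⇒x∉q (trans (tight-balanced Vg≡Eg) (p⊆q⇒∣p─q∣≡0 Eg⊆Ê))

    balanced-factor-vertices : ∣ Vg ∣ ≡ ∣ Eg ∣ → Vg ⊆ V̂ → ∀ {x} → x ∈ Eg → x ∉ Ê
    balanced-factor-vertices Vg≡Eg Vg⊆V̂ = ∣p∩q∣≡0⇒x∉q (+-cancelʳ-≡ ∣ Eg ─ Ê ∣ _ 0 (begin
      ∣ Eg ∩ Ê ∣ + ∣ Eg ─ Ê ∣ ≡⟨ sym (∣p∣≡∣p∩q∣+∣p─q∣ Eg Ê) ⟩
      ∣ Eg ∣                  ≡⟨ sym Vg≡Eg ⟩
      ∣ Vg ∣                  ≡⟨ sym (p⊆q⇒∣p∩q∣≡∣p∣ Vg⊆V̂) ⟩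
      ∣ Vg ∩ V̂ ∣              ≡⟨ tight-balanced Vg≡Eg ⟩
      ∣ Eg ─ Ê ∣              ∎))
      where open ≡-Reasoning

-- Spectral decompositions and exterior covers

module _ (H : Hypergraph) where

  Factor : Set
  Factor = Subset (n H) × Subset (m H)

  infix 4 _≤ᵈ_
  _≤ᵈ_ : Factor → Factor → Set
  (Vs , Es) ≤ᵈ (Vg , Eg) = ∣ Es ∣ * ∣ Vg ∣ ≤ ∣ Eg ∣ * ∣ Vs ∣

  Dense NonSparse Sparse Balanced : Factor → Set
  Dense     g = ∣ proj₁ g ∣ < ∣ proj₂ g ∣
  NonSparse g = ∣ proj₁ g ∣ ≤ ∣ proj₂ g ∣
  Sparse    g = ∣ proj₂ g ∣ < ∣ proj₁ g ∣
  Balanced  g = ∣ proj₂ g ∣ ≡ ∣ proj₁ g ∣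

  EdgesMeet : Subset (n H) → Subset (m H) → Set
  EdgesMeet V″ E″ = ∀ {e} → e ∈ E″ → Nonempty (supp H e ∩ V″)

  factors-nonempty : ∀ {V″ E″ fs} → IsSpectralDecompositionFrom H V″ E″ fs →
                     All (λ g → 0 < ∣ proj₁ g ∣) fs
  factors-nonempty {fs = []}    _                                 = []
  factors-nonempty {fs = _ ∷ _} (((_ , 0<∣Vα∣ , _) , _) , quotient) = 0<∣Vα∣ ∷ factors-nonempty quotient

  vertex-in-factor : ∀ {V″ E″ fs v} → IsSpectralDecompositionFrom H V″ E″ fs → v ∈ V″ →
                     Any (λ g → v ∈ proj₁ g) fs
  vertex-in-factor {fs = []}            (refl , _)   v∈⊥  = ⊥-elim (∉⊥ v∈⊥)
  vertex-in-factor {fs = (Vα , _) ∷ _} {v} (_ , quotient) v∈V″ with v ∈? Vα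
  ... | yes v∈Vα = here v∈Vα
  ... | no  v∉Vα = there (vertex-in-factor quotient (x∈p∧x∉q⇒x∈p─q v∈V″ v∉Vα))

  edge-in-factor : ∀ {V″ E″ fs e} → IsSpectralDecompositionFrom H V″ E″ fs → e ∈ E″ →
                   Any (λ g → e ∈ proj₂ g) fs
  edge-in-factor {fs = []}            (_ , refl)   e∈⊥  = ⊥-elim (∉⊥ e∈⊥)
  edge-in-factor {fs = (_ , Eα) ∷ _} {e = e} (_ , quotient) e∈E″ with e ∈? Eα
  ... | yes e∈Eα = here e∈Eα
  ... | no  e∉Eα = there (edge-in-factor quotient (x∈p∧x∉q⇒x∈p─q e∈E″ e∉Eα))

  -- An edge meeting V″ only inside Vα could be added to Eα without lowering the density.
  quotient-edgesMeet : ∀ {V″ E″ Vα Eα} → IsMaximalMaxDensitySubgraph H V″ E″ Vα Eα →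
                       EdgesMeet (V″ ─ Vα) (E″ ─ Eα)
  quotient-edgesMeet {V″} {E″} {Vα} {Eα}
    (((Vα⊆V″ , Eα⊆E″ , closed) , 0<∣Vα∣ , densest) , maximal) {e} e∈E″─Eα
    with nonempty? (supp H e ∩ (V″ ─ Vα))
  ... | yes meets = meets
  ... | no  misses = contradiction e∈Eα (x∈p─q⇒x∉q E″ Eα e∈E″─Eα)
    where
    supp⊆Vα : supp H e ∩ V″ ⊆ Vα
    supp⊆Vα {x} x∈ with x ∈? Vα
    ... | yes x∈Vα = x∈Vα
    ... | no  x∉Vα = ⊥-elim (misses (x , x∈p∩q∧x∉r⇒x∈p∩q─r x∈ x∉Vα))
    extended : IsMaxDensitySubgraph H V″ E″ Vα (Eα ∪ ⁅ e ⁆)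
    extended =
      ( Vα⊆V″
      , (λ d∈ → [ Eα⊆E″ , (λ d∈⁅e⁆ → subst (_∈ E″) (sym (x∈⁅y⁆⇒x≡y e d∈⁅e⁆)) (p─q⊆p E″ Eα e∈E″─Eα)) ]′
                  (x∈p∪q⁻ Eα ⁅ e ⁆ d∈))
      , λ d d∈ → [ closed d
                 , (λ d∈⁅e⁆ → subst (λ d → supp H d ∩ V″ ⊆ Vα) (sym (x∈⁅y⁆⇒x≡y e d∈⁅e⁆)) supp⊆Vα) ]′
                   (x∈p∪q⁻ Eα ⁅ e ⁆ d∈) )
      , 0<∣Vα∣
      , λ V₂ E₂ sub 0<∣V₂∣ → ≤-trans (densest V₂ E₂ sub 0<∣V₂∣) (*-monoˡ-≤ ∣ V₂ ∣ (∣p∣≤∣p∪q∣ Eα ⁅ e ⁆))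
    e∈Eα : e ∈ Eα
    e∈Eα = subst (e ∈_) (proj₂ (maximal Vα (Eα ∪ ⁅ e ⁆) extended ⊆-refl (p⊆p∪q ⁅ e ⁆)))
                 (q⊆p∪q Eα ⁅ e ⁆ (x∈⁅x⁆ e))

  quotient-subgraph-sparser : ∀ {V″ E″ Vα Eα V′ E′} → IsMaxDensitySubgraph H V″ E″ Vα Eα →
                              IsSubgraphOf H (V″ ─ Vα) (E″ ─ Eα) V′ E′ → (V′ , E′) ≤ᵈ (Vα , Eα)
  quotient-subgraph-sparser {V″} {E″} {Vα} {Eα} {V′} {E′}
    ((Vα⊆V″ , Eα⊆E″ , closedα) , 0<∣Vα∣ , densest) (V′⊆ , E′⊆ , closed′) =
    mediant-≤ (∣ Eα ∣) (∣ E′ ∣) (∣ Vα ∣) (∣ V′ ∣) (subst₂ _≤_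
      (cong (_* ∣ Vα ∣) (∣p∪q∣≡∣p∣+∣q∣ λ x∈Eα x∈E′ → x∈p─q⇒x∉q E″ Eα (E′⊆ x∈E′) x∈Eα))
      (cong (∣ Eα ∣ *_) (∣p∪q∣≡∣p∣+∣q∣ λ x∈Vα x∈V′ → x∈p─q⇒x∉q V″ Vα (V′⊆ x∈V′) x∈Vα))
      (densest (Vα ∪ V′) (Eα ∪ E′) union (<-≤-trans 0<∣Vα∣ (∣p∣≤∣p∪q∣ Vα V′))))
    where
    supp⊆Vα∪V′ : ∀ {e} → e ∈ E′ → supp H e ∩ V″ ⊆ Vα ∪ V′
    supp⊆Vα∪V′ {e} e∈E′ {x} x∈ with x ∈? Vα
    ... | yes x∈Vα = p⊆p∪q V′ x∈Vα
    ... | no  x∉Vα = q⊆p∪q Vα V′ (closed′ e e∈E′ (x∈p∩q∧x∉r⇒x∈p∩q─r x∈ x∉Vα))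
    union : IsSubgraphOf H V″ E″ (Vα ∪ V′) (Eα ∪ E′)
    union = (λ x∈ → [ Vα⊆V″ , (λ x∈V′ → p─q⊆p V″ Vα (V′⊆ x∈V′)) ]′ (x∈p∪q⁻ Vα V′ x∈))
          , (λ e∈ → [ Eα⊆E″ , (λ e∈E′ → p─q⊆p E″ Eα (E′⊆ e∈E′)) ]′ (x∈p∪q⁻ Eα E′ e∈))
          , λ e e∈ x∈ → [ (λ e∈Eα → p⊆p∪q V′ (closedα e e∈Eα x∈)) , (λ e∈E′ → supp⊆Vα∪V′ e∈E′ x∈) ]′
                          (x∈p∪q⁻ Eα E′ e∈)

  ≤ᵈ-trans : ∀ {s t g} → 0 < ∣ proj₁ t ∣ → s ≤ᵈ t → t ≤ᵈ g → s ≤ᵈ g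
  ≤ᵈ-trans {s} {t} {g} =
    cross-≤-trans {∣ proj₁ s ∣} {∣ proj₂ s ∣} {∣ proj₁ t ∣} {∣ proj₂ t ∣} {∣ proj₁ g ∣} {∣ proj₂ g ∣}

  later-factors-sparser : ∀ {V″ E″ g fs} → IsSpectralDecompositionFrom H V″ E″ (g ∷ fs) → All (_≤ᵈ g) fs
  later-factors-sparser {fs = []}    _ = []
  later-factors-sparser {g = g} {fs = s ∷ _}
    ((densest-g , _) , quotient@(((sub-s , 0<∣Vs∣ , _) , _) , _)) =
    s≤g ∷ All.map (λ {t} t≤s → ≤ᵈ-trans {t} {s} {g} 0<∣Vs∣ t≤s s≤g) (later-factors-sparser quotient)
    where s≤g = quotient-subgraph-sparser densest-g sub-s

  covered-factor-bound : ∀ {V″ E″ Vα Eα V̂ Ê} → IsMaxDensitySubgraph H V″ E″ Vα Eα → EdgesMeet V″ E″ →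
                         IsExteriorCover H V̂ Ê → CoverBound V̂ Ê (Vα , Eα)
  covered-factor-bound {V″} {E″} {Vα} {Eα} {V̂} {Ê}
    ((Vα⊆V″ , Eα⊆E″ , closed) , 0<∣Vα∣ , densest) meet cover = coverBound 0<∣Vα∣ (bound (nonempty? (Eα ─ Ê)))
    where
    covered-vertex : ∀ {e x} → e ∈ Eα ─ Ê → x ∈ supp H e ∩ V″ → x ∈ Vα ∩ V̂
    covered-vertex {e} {x} e∈Eα─Ê x∈ =
      x∈p∩q⁺ ( closed e (p─q⊆p Eα Ê e∈Eα─Ê) x∈
             , [ id , (λ e∈Ê → ⊥-elim (x∈p─q⇒x∉q Eα Ê e∈Eα─Ê e∈Ê)) ]′ (cover x e (proj₁ (x∈p∩q⁻ _ _ x∈))) )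
    uncovered : IsSubgraphOf H V″ E″ (Vα ∩ V̂) (Eα ─ Ê)
    uncovered = (λ x∈ → Vα⊆V″ (proj₁ (x∈p∩q⁻ Vα V̂ x∈)))
              , (λ e∈ → Eα⊆E″ (p─q⊆p Eα Ê e∈))
              , λ e e∈ → covered-vertex e∈
    bound : Dec (Nonempty (Eα ─ Ê)) → ∣ Eα ─ Ê ∣ * ∣ Vα ∣ ≤ ∣ Eα ∣ * ∣ Vα ∩ V̂ ∣
    bound (yes (e , e∈Eα─Ê)) = densest (Vα ∩ V̂) (Eα ─ Ê) uncovered
      (x∈p⇒0<∣p∣ (covered-vertex e∈Eα─Ê (proj₂ (meet (Eα⊆E″ (p─q⊆p Eα Ê e∈Eα─Ê))))))
    bound (no empty) = subst (λ u → u * ∣ Vα ∣ ≤ _) (sym (Empty⇒∣p∣≡0 empty)) z≤n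

  cover-bounds : ∀ {V″ E″ fs V̂ Ê} → IsSpectralDecompositionFrom H V″ E″ fs → EdgesMeet V″ E″ →
                 IsExteriorCover H V̂ Ê → All (CoverBound V̂ Ê) fs
  cover-bounds {fs = []}    _                              _    _     = []
  cover-bounds {fs = _ ∷ _} (maximal@(densest , _) , quotient) meet cover =
    covered-factor-bound densest meet cover ∷ cover-bounds quotient (quotient-edgesMeet maximal) cover

  cover-cost-split : ∀ {V″ E″ fs} (V̂ : Subset (n H)) (Ê : Subset (m H)) →
                     IsSpectralDecompositionFrom H V″ E″ fs →
                     ∣ V″ ∩ V̂ ∣ + ∣ E″ ∩ Ê ∣ ≡ sum (map (coverCost V̂ Ê) fs)
  cover-cost-split {fs = []} V̂ Ê (refl , refl) = cong₂ _+_ (∣⊥∩p∣≡0 V̂) (∣⊥∩p∣≡0 Ê)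
  cover-cost-split {V″} {E″} {(Vα , Eα) ∷ fs} V̂ Ê ((((Vα⊆V″ , Eα⊆E″ , _) , _) , _) , quotient) = begin
    ∣ V″ ∩ V̂ ∣ + ∣ E″ ∩ Ê ∣
      ≡⟨ cong₂ _+_ (∣p∩r∣≡∣q∩r∣+∣p─q∩r∣ V″ Vα V̂ Vα⊆V″) (∣p∩r∣≡∣q∩r∣+∣p─q∩r∣ E″ Eα Ê Eα⊆E″) ⟩
    (∣ Vα ∩ V̂ ∣ + ∣ (V″ ─ Vα) ∩ V̂ ∣) + (∣ Eα ∩ Ê ∣ + ∣ (E″ ─ Eα) ∩ Ê ∣)
      ≡⟨ interchange (∣ Vα ∩ V̂ ∣) _ (∣ Eα ∩ Ê ∣) _ ⟩
    coverCost V̂ Ê (Vα , Eα) + (∣ (V″ ─ Vα) ∩ V̂ ∣ + ∣ (E″ ─ Eα) ∩ Ê ∣)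
      ≡⟨ cong (coverCost V̂ Ê (Vα , Eα) +_) (cover-cost-split V̂ Ê quotient) ⟩
    sum (map (coverCost V̂ Ê) ((Vα , Eα) ∷ fs)) ∎
    where open ≡-Reasoning

  balanced-if-neither : ∀ {M : Factor → Set} {gs} → Any M gs →
                        ¬ Any (λ g → Dense g × M g) gs → ¬ Any (λ g → Sparse g × M g) gs →
                        Any (λ g → Balanced g × M g) gs
  balanced-if-neither {gs = g ∷ _} (here Mg) ¬dense ¬sparse with <-cmp ∣ proj₁ g ∣ ∣ proj₂ g ∣
  ... | tri< dense _ _      = contradiction (here (dense , Mg)) ¬dense
  ... | tri≈ _ balanced _   = here (sym balanced , Mg)
  ... | tri> _ _ sparse     = contradiction (here (sparse , Mg)) ¬sparse
  balanced-if-neither (there any) ¬dense ¬sparse =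
    there (balanced-if-neither any (¬dense ∘ there) (¬sparse ∘ there))

  module Selection {P : Factor → Set} (P? : Decidable P) where

    Selects : Subset (n H) → Subset (m H) → Factor → Set
    Selects V̂ Ê g = (P g → proj₁ g ⊆ V̂) × (¬ P g → proj₂ g ⊆ Ê)

    vertexPart : Factor → Subset (n H)
    vertexPart g = if does (P? g) then proj₁ g else ⊥

    edgePart : Factor → Subset (m H)
    edgePart g = if does (P? g) then ⊥ else proj₂ g

    selectedVertices : List Factor → Subset (n H)
    selectedVertices gs = ⋃ (map vertexPart gs)

    selectedEdges : List Factor → Subset (m H)
    selectedEdges gs = ⋃ (map edgePart gs)

    parts-select : ∀ g → Selects (vertexPart g) (edgePart g) g
    parts-select g with P? g
    ... | yes Pg = (λ _ → id) , (λ ¬Pg → contradiction Pg ¬Pg)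
    ... | no ¬Pg = (λ Pg → contradiction Pg ¬Pg) , (λ _ → id)

    vertexPart⁻ : ∀ {g x} → x ∈ vertexPart g → P g × x ∈ proj₁ g
    vertexPart⁻ {g} x∈ with P? g
    ... | yes Pg = Pg , x∈
    ... | no  _  = ⊥-elim (∉⊥ x∈)

    edgePart⁻ : ∀ {g x} → x ∈ edgePart g → ¬ P g × x ∈ proj₂ g
    edgePart⁻ {g} x∈ with P? g
    ... | yes _   = ⊥-elim (∉⊥ x∈)
    ... | no  ¬Pg = ¬Pg , x∈

    selection-selects : ∀ gs → All (Selects (selectedVertices gs) (selectedEdges gs)) gs
    selection-selects gs = All.zipWith select
      (All.map⁻ (⊆⋃ (map vertexPart gs)) , All.map⁻ (⊆⋃ (map edgePart gs)))
      where
      select : ∀ {g} → vertexPart g ⊆ selectedVertices gs × edgePart g ⊆ selectedEdges gs →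
               Selects (selectedVertices gs) (selectedEdges gs) g
      select {g} (vertices⊆ , edges⊆) =
        (λ Pg x∈ → vertices⊆ (proj₁ (parts-select g) Pg x∈)) ,
        (λ ¬Pg x∈ → edges⊆ (proj₂ (parts-select g) ¬Pg x∈))

    selectedVertices⁻ : ∀ {gs x} → x ∈ selectedVertices gs → Any (λ g → P g × x ∈ proj₁ g) gs
    selectedVertices⁻ {gs} x∈ = Any.map vertexPart⁻ (Any.map⁻ (x∈⋃⇒Any (map vertexPart gs) x∈))

    selectedEdges⁻ : ∀ {gs x} → x ∈ selectedEdges gs → Any (λ g → ¬ P g × x ∈ proj₂ g) gs
    selectedEdges⁻ {gs} x∈ = Any.map edgePart⁻ (Any.map⁻ (x∈⋃⇒Any (map edgePart gs) x∈))

    module _ (P⇒≤ : ∀ {g} → P g → ∣ proj₁ g ∣ ≤ ∣ proj₂ g ∣)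
             (¬P⇒≥ : ∀ {g} → ¬ P g → ∣ proj₂ g ∣ ≤ ∣ proj₁ g ∣) where

      parts-size : ∀ g → ∣ vertexPart g ∣ + ∣ edgePart g ∣ ≡ minSize g
      parts-size g with P? g
      ... | yes Pg  = trans (cong (∣ proj₁ g ∣ +_) (∣⊥∣≡0 (m H)))
                            (trans (+-identityʳ _) (sym (m≤n⇒m⊓n≡m (P⇒≤ Pg))))
      ... | no  ¬Pg = trans (cong (_+ ∣ proj₂ g ∣) (∣⊥∣≡0 (n H))) (sym (m≥n⇒m⊓n≡n (¬P⇒≥ ¬Pg)))

      selection-size : ∀ gs → ∣ selectedVertices gs ∣ + ∣ selectedEdges gs ∣ ≤ sum (map minSize gs)
      selection-size []       = ≤-reflexive (cong₂ _+_ (∣⊥∣≡0 (n H)) (∣⊥∣≡0 (m H)))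
      selection-size (g ∷ gs) = begin
        ∣ vertexPart g ∪ selectedVertices gs ∣ + ∣ edgePart g ∪ selectedEdges gs ∣
          ≤⟨ +-mono-≤ (∣p∪q∣≤∣p∣+∣q∣ (vertexPart g) _) (∣p∪q∣≤∣p∣+∣q∣ (edgePart g) _) ⟩
        (∣ vertexPart g ∣ + ∣ selectedVertices gs ∣) + (∣ edgePart g ∣ + ∣ selectedEdges gs ∣)
          ≡⟨ interchange (∣ vertexPart g ∣) _ (∣ edgePart g ∣) _ ⟩
        (∣ vertexPart g ∣ + ∣ edgePart g ∣) + (∣ selectedVertices gs ∣ + ∣ selectedEdges gs ∣)
          ≤⟨ +-mono-≤ (≤-reflexive (parts-size g)) (selection-size gs) ⟩
        minSize g + sum (map minSize gs) ∎
        where open ≤-Reasoning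

    module _ (P-upward : ∀ {g s} → 0 < ∣ proj₁ g ∣ → 0 < ∣ proj₁ s ∣ → s ≤ᵈ g → P s → P g) where

      -- When v ∈ Vα and (Vα, Eα) takes its edges, so does the factor containing e, which comes
      -- no earlier and is therefore no denser.
      selection-covers : ∀ {V″ E″ fs V̂ Ê} → IsSpectralDecompositionFrom H V″ E″ fs →
                         All (Selects V̂ Ê) fs →
                         ∀ {v e} → v ∈ supp H e → v ∈ V″ → e ∈ E″ → v ∈ V̂ ⊎ e ∈ Ê
      selection-covers {fs = []} (refl , _) _ _ v∈⊥ _ = ⊥-elim (∉⊥ v∈⊥)
      selection-covers {fs = g@(Vα , _) ∷ _} {V̂} {Ê}
        spectral@((((_ , _ , closed) , 0<∣Vα∣ , _) , _) , quotient) (selects-g ∷ selects)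
        {v} {e} v∈supp v∈V″ e∈E″ with v ∈? Vα | P? g
      ... | yes v∈Vα | yes Pg  = inj₁ (proj₁ selects-g Pg v∈Vα)
      ... | yes _    | no  ¬Pg = inj₂ (lookupWith edge-selected
            (All.zip (selects-g ∷ selects , All.zip (≤-refl ∷ later-factors-sparser spectral ,
                                                      factors-nonempty spectral)))
            (edge-in-factor spectral e∈E″))
        where
        edge-selected : ∀ {s} → Selects V̂ Ê s × s ≤ᵈ g × 0 < ∣ proj₁ s ∣ → e ∈ proj₂ s → e ∈ Ê
        edge-selected (selects-s , s≤g , 0<∣Vs∣) e∈Es =
          proj₂ selects-s (¬Pg ∘ P-upward 0<∣Vα∣ 0<∣Vs∣ s≤g) e∈Es
      ... | no  v∉Vα | _ = selection-covers quotient selects v∈supp (x∈p∧x∉q⇒x∈p─q v∈V″ v∉Vα)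
            (x∈p∧x∉q⇒x∈p─q e∈E″ λ e∈Eα → v∉Vα (closed e e∈Eα (x∈p∩q⁺ (v∈supp , v∈V″))))

  dense? : Decidable Dense
  dense? g = ∣ proj₁ g ∣ <? ∣ proj₂ g ∣

  nonsparse? : Decidable NonSparse
  nonsparse? g = ∣ proj₁ g ∣ ≤? ∣ proj₂ g ∣

  open Selection

  module Classification (no-empty-edge : NoEmptyEdge H) {fs : List Factor}
                        (spectral : IsSpectralDecomposition H fs) where

    edgesMeet : EdgesMeet ⊤ ⊤
    edgesMeet {e} _ = proj₁ (no-empty-edge e) , x∈p∩q⁺ (proj₂ (no-empty-edge e) , ∈⊤)

    cover-size : ∀ V̂ Ê → ∣ V̂ ∣ + ∣ Ê ∣ ≡ sum (map (coverCost V̂ Ê) fs)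
    cover-size V̂ Ê = trans (cong₂ _+_ (cong ∣_∣ (sym (∩-identityˡ V̂))) (cong ∣_∣ (sym (∩-identityˡ Ê))))
                           (cover-cost-split V̂ Ê spectral)

    cover-lower : ∀ {V̂ Ê} → IsExteriorCover H V̂ Ê → sum (map minSize fs) ≤ ∣ V̂ ∣ + ∣ Ê ∣
    cover-lower {V̂} {Ê} cover = begin
      sum (map minSize fs)        ≤⟨ sum-mono-≤ (All.map FactorCover.minSize≤coverCost
                                                  (cover-bounds spectral edgesMeet cover)) ⟩
      sum (map (coverCost V̂ Ê) fs) ≡⟨ sym (cover-size V̂ Ê) ⟩
      ∣ V̂ ∣ + ∣ Ê ∣               ∎
      where open ≤-Reasoning

    selection-minimal : ∀ {P} (P? : Decidable P) →
      (∀ {g s} → 0 < ∣ proj₁ g ∣ → 0 < ∣ proj₁ s ∣ → s ≤ᵈ g → P s → P g) →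
      (∀ {g} → P g → ∣ proj₁ g ∣ ≤ ∣ proj₂ g ∣) → (∀ {g} → ¬ P g → ∣ proj₂ g ∣ ≤ ∣ proj₁ g ∣) →
      IsMinimalExteriorCover H (selectedVertices P? fs) (selectedEdges P? fs)
    selection-minimal P? P-upward P⇒≤ ¬P⇒≥ =
      (λ _ _ v∈supp → selection-covers P? P-upward spectral (selection-selects P? fs) v∈supp ∈⊤ ∈⊤) ,
      λ _ _ cover → ≤-trans (selection-size P? P⇒≤ ¬P⇒≥ fs) (cover-lower cover)

    dense-minimal : IsMinimalExteriorCover H (selectedVertices dense? fs) (selectedEdges dense? fs)
    dense-minimal = selection-minimal dense? (λ 0<∣Vg∣ _ → >1-upward 0<∣Vg∣) <⇒≤ ≮⇒≥

    nonsparse-minimal :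
      IsMinimalExteriorCover H (selectedVertices nonsparse? fs) (selectedEdges nonsparse? fs)
    nonsparse-minimal = selection-minimal nonsparse? (λ _ 0<∣Vs∣ → ≥1-upward 0<∣Vs∣) id (<⇒≤ ∘ ≰⇒>)

    minimal-tight : ∀ {V̂ Ê} → IsMinimalExteriorCover H V̂ Ê →
                    All (λ g → CoverBound V̂ Ê g × coverCost V̂ Ê g ≤ minSize g) fs
    minimal-tight {V̂} {Ê} (cover , minimal) = All.zip (bounds , sum-tight
      (All.map FactorCover.minSize≤coverCost bounds) (begin
        sum (map (coverCost V̂ Ê) fs)                                   ≡⟨ sym (cover-size V̂ Ê) ⟩
        ∣ V̂ ∣ + ∣ Ê ∣                                                  ≤⟨ minimal _ _ (proj₁ dense-minimal) ⟩
        ∣ selectedVertices dense? fs ∣ + ∣ selectedEdges dense? fs ∣ ≤⟨ selection-size dense? <⇒≤ ≮⇒≥ fs ⟩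
        sum (map minSize fs)                                           ∎))
      where
      open ≤-Reasoning
      bounds : All (CoverBound V̂ Ê) fs
      bounds = cover-bounds spectral edgesMeet cover

    dense⇒V⁺ : ∀ {v} → Any (λ g → Dense g × v ∈ proj₁ g) fs → InV⁺ H v
    dense⇒V⁺ any _ _ minimal = lookupWith
      (λ (bound , tight) (dense , v∈Vg) → proj₁ (FactorCover.dense-factor bound tight dense) v∈Vg)
      (minimal-tight minimal) any

    V⁺⇒dense : ∀ {v} → InV⁺ H v → Any (λ g → Dense g × v ∈ proj₁ g) fs
    V⁺⇒dense v∈V⁺ = selectedVertices⁻ dense? (v∈V⁺ _ _ dense-minimal)

    sparse⇒V⁻ : ∀ {v} → Any (λ g → Sparse g × v ∈ proj₁ g) fs → InV⁻ H v
    sparse⇒V⁻ any _ _ minimal = lookupWith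
      (λ (bound , tight) (sparse , v∈Vg) → proj₁ (FactorCover.sparse-factor bound tight sparse) v∈Vg)
      (minimal-tight minimal) any

    V⁻⇒sparse : ∀ {v} → InV⁻ H v → Any (λ g → Sparse g × v ∈ proj₁ g) fs
    V⁻⇒sparse v∈V⁻ = Any.map
      (λ (selects , v∈Vg) →
        ≰⇒> (λ nonsparse → v∈V⁻ _ _ nonsparse-minimal (proj₁ selects nonsparse v∈Vg)) , v∈Vg)
      (All∧Any⇒Any (selection-selects nonsparse? fs) (vertex-in-factor spectral ∈⊤))

    balanced⇒V⁰ : ∀ {v} → Any (λ g → Balanced g × v ∈ proj₁ g) fs → InV⁰ H v
    balanced⇒V⁰ any =
      (λ v∈V⁺ → lookupWith
        (λ ((bound , tight) , selects) (balanced , v∈Vg) →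
          FactorCover.balanced-factor-edges bound tight (sym balanced)
            (proj₂ selects (λ dense → <⇒≢ dense (sym balanced))) v∈Vg (v∈V⁺ _ _ dense-minimal))
        (All.zip (minimal-tight dense-minimal , selection-selects dense? fs)) any) ,
      (λ v∈V⁻ → lookupWith
        (λ selects (balanced , v∈Vg) →
          v∈V⁻ _ _ nonsparse-minimal (proj₁ selects (≤-reflexive (sym balanced)) v∈Vg))
        (selection-selects nonsparse? fs) any)

    V⁰⇒balanced : ∀ {v} → InV⁰ H v → Any (λ g → Balanced g × v ∈ proj₁ g) fs
    V⁰⇒balanced (v∉V⁺ , v∉V⁻) =
      balanced-if-neither (vertex-in-factor spectral ∈⊤) (v∉V⁺ ∘ dense⇒V⁺) (v∉V⁻ ∘ sparse⇒V⁻)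

    dense⇒E⁺ : ∀ {e} → Any (λ g → Dense g × e ∈ proj₂ g) fs → InE⁺ H e
    dense⇒E⁺ any _ _ minimal = lookupWith
      (λ (bound , tight) (dense , e∈Eg) → proj₂ (FactorCover.dense-factor bound tight dense) e∈Eg)
      (minimal-tight minimal) any

    E⁺⇒dense : ∀ {e} → InE⁺ H e → Any (λ g → Dense g × e ∈ proj₂ g) fs
    E⁺⇒dense e∈E⁺ = Any.map
      (λ {g} (selects , e∈Eg) →
        decidable-stable (dense? g) (λ ¬dense → e∈E⁺ _ _ dense-minimal (proj₂ selects ¬dense e∈Eg)) , e∈Eg)
      (All∧Any⇒Any (selection-selects dense? fs) (edge-in-factor spectral ∈⊤))

    sparse⇒E⁻ : ∀ {e} → Any (λ g → Sparse g × e ∈ proj₂ g) fs → InE⁻ H e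
    sparse⇒E⁻ any _ _ minimal = lookupWith
      (λ (bound , tight) (sparse , e∈Eg) → proj₂ (FactorCover.sparse-factor bound tight sparse) e∈Eg)
      (minimal-tight minimal) any

    E⁻⇒sparse : ∀ {e} → InE⁻ H e → Any (λ g → Sparse g × e ∈ proj₂ g) fs
    E⁻⇒sparse e∈E⁻ = Any.map (λ (¬nonsparse , e∈Eg) → ≰⇒> ¬nonsparse , e∈Eg)
                             (selectedEdges⁻ nonsparse? (e∈E⁻ _ _ nonsparse-minimal))

    balanced⇒E⁰ : ∀ {e} → Any (λ g → Balanced g × e ∈ proj₂ g) fs → InE⁰ H e
    balanced⇒E⁰ any =
      (λ e∈E⁺ → lookupWith
        (λ selects (balanced , e∈Eg) →
          e∈E⁺ _ _ dense-minimal (proj₂ selects (λ dense → <⇒≢ dense (sym balanced)) e∈Eg))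
        (selection-selects dense? fs) any) ,
      (λ e∈E⁻ → lookupWith
        (λ ((bound , tight) , selects) (balanced , e∈Eg) →
          FactorCover.balanced-factor-vertices bound tight (sym balanced)
            (proj₁ selects (≤-reflexive (sym balanced))) e∈Eg (e∈E⁻ _ _ nonsparse-minimal))
        (All.zip (minimal-tight nonsparse-minimal , selection-selects nonsparse? fs)) any)

    E⁰⇒balanced : ∀ {e} → InE⁰ H e → Any (λ g → Balanced g × e ∈ proj₂ g) fs
    E⁰⇒balanced (e∉E⁺ , e∉E⁻) =
      balanced-if-neither (edge-in-factor spectral ∈⊤) (e∉E⁺ ∘ dense⇒E⁺) (e∉E⁻ ∘ sparse⇒E⁻)

theorem9 : (H : Hypergraph) → NoIsolatedVertex H → NoEmptyEdge H →
    (fs : List (Subset (n H) × Subset (m H))) → IsSpectralDecomposition H fs →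
    ((v : Fin (n H)) → InV⁺ H v ⇔ Any (λ f → ∣ proj₁ f ∣ < ∣ proj₂ f ∣ × v ∈ proj₁ f) fs) ×
    ((v : Fin (n H)) → InV⁰ H v ⇔ Any (λ f → ∣ proj₂ f ∣ ≡ ∣ proj₁ f ∣ × v ∈ proj₁ f) fs) ×
    ((v : Fin (n H)) → InV⁻ H v ⇔ Any (λ f → ∣ proj₂ f ∣ < ∣ proj₁ f ∣ × v ∈ proj₁ f) fs) ×
    ((e : Fin (m H)) → InE⁺ H e ⇔ Any (λ f → ∣ proj₁ f ∣ < ∣ proj₂ f ∣ × e ∈ proj₂ f) fs) ×
    ((e : Fin (m H)) → InE⁰ H e ⇔ Any (λ f → ∣ proj₂ f ∣ ≡ ∣ proj₁ f ∣ × e ∈ proj₂ f) fs) ×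
    ((e : Fin (m H)) → InE⁻ H e ⇔ Any (λ f → ∣ proj₂ f ∣ < ∣ proj₁ f ∣ × e ∈ proj₂ f) fs)
theorem9 H _ no-empty-edge fs spectral =
  (λ _ → mk⇔ V⁺⇒dense dense⇒V⁺) ,
  (λ _ → mk⇔ V⁰⇒balanced balanced⇒V⁰) ,
  (λ _ → mk⇔ V⁻⇒sparse sparse⇒V⁻) ,
  (λ _ → mk⇔ E⁺⇒dense dense⇒E⁺) ,
  (λ _ → mk⇔ E⁰⇒balanced balanced⇒E⁰) ,
  (λ _ → mk⇔ E⁻⇒sparse sparse⇒E⁻)
  where open Classification H no-empty-edge spectral
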